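{- Let $\alpha\ge1$ and let $A$ be an $\alpha$-approximation algorithm for BCMD-$\delta$. Then $A$ is a $2\alpha$-approximation for the colored variant: for every graph $G=(V,E)$, integers $k,\delta\ge1$, and partition $V=V_1\cup V_2$ with $V_1,V_2\neq\emptyset$, $V_1\cap V_2=\emptyset$, the augmented graph returned by $A$ on $(G,k,\delta)$ has colored diameter at most $2\alpha D^*_{\mathrm{col}}$, where $D^*_{\mathrm{col}}$ is the minimum colored diameter achievable by adding at most $k$ non-edges to $G$ while increasing each vertex degree by at most $\delta$.
   Context: Graphs are simple, undirected, unweighted. Problem BCMD-$\delta$: given $G$ and integers $k,\delta\ge1$, find a set $M$ of at most $k$ non-edges of $G$ minimizing the diameter of $G'=(V,E\cup M)$ subject to $\deg_{G'}(v)\le\deg_G(v)+\delta$ for all $v$. An $\alpha$-approximation algorithm returns a feasible $M$ whose resulting diameter is at most $\alpha$ times the optimum. Given a partition $V=V_1\cup V_2$ into nonempty disjoint sets, the colored diameter of a graph is the largest shortest-path distance between a vertex of $V_1$ and a vertex of $V_2$.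
   Formalization: The approximation factor α ranges over the rationals. -}

module Defs where

open import Data.Nat using (ℕ; zero; suc)
open import Data.Bool using (Bool; true; false; _∨_; if_then_else_)
open import Data.Fin using (Fin; _≟_)
open import Data.Product using (_×_; _,_; ∃; ∃-syntax; Σ-syntax)
open import Data.List using (List; []; _∷_; length; map; allFin)
open import Data.Nat.ListAction using (sum)
open import Data.List.Relation.Unary.All using (All)
open import Data.List.Relation.Unary.AllPairs using (AllPairs)
open import Data.Integer using (+_)
open import Data.Rational using (ℚ; _/_; _*_; _≤_)
open import Relation.Binary.PropositionalEquality using (_≡_; _≢_)
open import Relation.Nullary using (¬_; does)

record Graph (n : ℕ) : Set where
  field
    adj   : Fin n → Fin n → Bool
    sym   : ∀ u v → adj u v ≡ adj v u
    irrefl : ∀ u → adj u u ≡ false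
open Graph public

-- A candidate set of added edges: a list of vertex pairs (each pair an
-- unordered edge {u,v}).
EdgeList : ℕ → Set
EdgeList n = List (Fin n × Fin n)

inM : ∀ {n} → EdgeList n → Fin n → Fin n → Bool
inM [] u v = false
inM ((a , b) ∷ M) u v =
  ((does (a ≟ u) Data.Bool.∧ does (b ≟ v)) ∨ (does (a ≟ v) Data.Bool.∧ does (b ≟ u))) ∨ inM M u v

augAdj : ∀ {n} → Graph n → EdgeList n → Fin n → Fin n → Bool
augAdj G M u v = adj G u v ∨ inM M u v

degree : ∀ {n} → (Fin n → Fin n → Bool) → Fin n → ℕ
degree {n} a v = sum (map (λ u → if a v u then 1 else 0) (allFin n))

SamePair : ∀ {n} → (Fin n × Fin n) → (Fin n × Fin n) → Set
SamePair (a , b) (c , d) = (a ≡ c × b ≡ d) Data.Sum.⊎ (a ≡ d × b ≡ c)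
  where import Data.Sum

NonEdgeSet : ∀ {n} → Graph n → EdgeList n → Set
NonEdgeSet G M =
  All (λ p → Data.Product.proj₁ p ≢ Data.Product.proj₂ p
             × adj G (Data.Product.proj₁ p) (Data.Product.proj₂ p) ≡ false) M
  × AllPairs (λ p q → ¬ SamePair p q) M

Feasible : ∀ {n} → Graph n → (k δ : ℕ) → EdgeList n → Set
Feasible {n} G k δ M =
  NonEdgeSet G M
  × length M Data.Nat.≤ k
  × (∀ v → degree (augAdj G M) v Data.Nat.≤ degree (adj G) v Data.Nat.+ δ)

data Walk {n : ℕ} (a : Fin n → Fin n → Bool) : Fin n → Fin n → ℕ → Set where
  nil  : ∀ {u} → Walk a u u 0
  cons : ∀ {u w v l} → a u w ≡ true → Walk a w v l → Walk a u v (suc l)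

ℕtoℚ : ℕ → ℚ
ℕtoℚ d = (+ d) / 1

-- dist(u,v) ≤ x  (x rational), i.e. some walk of length ℓ with ℓ ≤ x;
-- this is false when u, v are disconnected (distance ∞).
DistAtMost : ∀ {n} → (Fin n → Fin n → Bool) → Fin n → Fin n → ℚ → Set
DistAtMost a u v x = ∃[ l ] (Walk a u v l × ℕtoℚ l ≤ x)

DiamAtMost : ∀ {n} → (Fin n → Fin n → Bool) → ℚ → Set
DiamAtMost a x = ∀ u v → DistAtMost a u v x

-- colored diameter ≤ x w.r.t. partition V1 = {v | c v ≡ true},
-- V2 = {v | c v ≡ false}
ColDiamAtMost : ∀ {n} → (Fin n → Bool) → (Fin n → Fin n → Bool) → ℚ → Set
ColDiamAtMost c a x = ∀ u v → c u ≡ true → c v ≡ false → DistAtMost a u v x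

Algorithm : Set
Algorithm = (n : ℕ) → Graph n → (k δ : ℕ) → EdgeList n

-- A is an α-approximation for BCMD-δ: on every instance (k, δ ≥ 1) it returns
-- a feasible M, and its diameter is at most α·OPT, i.e. at most α·D for
-- the diameter D of any feasible solution (vacuous if OPT = ∞).
IsApprox : ℚ → Algorithm → Set
IsApprox α A =
  ∀ n (G : Graph n) (k δ : ℕ) → 1 Data.Nat.≤ k → 1 Data.Nat.≤ δ →
    Feasible G k δ (A n G k δ)
    × (∀ (M : EdgeList n) (D : ℕ) → Feasible G k δ M →
         DiamAtMost (augAdj G M) (ℕtoℚ D) →
         DiamAtMost (augAdj G (A n G k δ)) (α * ℕtoℚ D))

{-# OPTIONS --safe #-}
-- An optimal colored solution M with colored diameter D already has diameter at
-- most 2D: two vertices of the same color are both within D of any vertex of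
-- the other color. Hence A, being an α-approximation for the diameter, returns a
-- graph of diameter at most 2αD, which bounds its colored diameter as well.
module Submission where

open import Defs
open import Data.Nat using (ℕ; _≤_)
open import Data.Bool using (Bool; true; false)
open import Data.Fin using (Fin)
open import Data.Product using (∃-syntax)
open import Data.Rational using (ℚ; 1ℚ; _*_)
open import Relation.Binary.PropositionalEquality using (_≡_)

import Data.Nat as ℕ
import Data.Nat.Properties as ℕ
import Data.Integer as ℤ
import Data.Integer.Properties as ℤ
import Data.Rational as ℚ
import Data.Rational.Properties as ℚ
open import Data.Integer using (+_)
open import Data.Nat.Coprimality using (1-coprimeTo) renaming (sym to coprime-sym)
open import Data.Bool using (_∨_; _∧_)
open import Data.Bool.Properties using (∨-comm)
open import Data.List using ([]; _∷_)
open import Data.Product using (_,_; proj₂; _×_)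
open import Relation.Nullary using (does)
open import Relation.Binary.PropositionalEquality
  using (refl; trans; cong; cong₂; subst; subst₂; module ≡-Reasoning) renaming (sym to ≡-sym)

ℕtoℚ≡mkℚ : ∀ d → ℕtoℚ d ≡ ℚ.mkℚ (+ d) 0 (coprime-sym (1-coprimeTo d))
ℕtoℚ≡mkℚ d = ℚ.normalize-coprime (coprime-sym (1-coprimeTo d))

ℕtoℚ-mono-≤ : ∀ {m n} → m ≤ n → ℕtoℚ m ℚ.≤ ℕtoℚ n
ℕtoℚ-mono-≤ {m} {n} m≤n rewrite ℕtoℚ≡mkℚ m | ℕtoℚ≡mkℚ n =
  ℚ.*≤* (subst₂ ℤ._≤_ (≡-sym (ℤ.*-identityʳ (+ m))) (≡-sym (ℤ.*-identityʳ (+ n))) (ℤ.+≤+ m≤n))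

ℕtoℚ-cancel-≤ : ∀ {m n} → ℕtoℚ m ℚ.≤ ℕtoℚ n → m ≤ n
ℕtoℚ-cancel-≤ {m} {n} p rewrite ℕtoℚ≡mkℚ m | ℕtoℚ≡mkℚ n
  with subst₂ ℤ._≤_ (ℤ.*-identityʳ (+ m)) (ℤ.*-identityʳ (+ n)) (ℚ.drop-*≤* p)
... | ℤ.+≤+ m≤n = m≤n

ℕtoℚ-*-homo : ∀ m n → ℕtoℚ (m ℕ.* n) ≡ ℕtoℚ m * ℕtoℚ n
ℕtoℚ-*-homo m n rewrite ℕtoℚ≡mkℚ m | ℕtoℚ≡mkℚ n =
  cong (ℚ._/ 1) (≡-sym (ℤ.+◃n≡+n (m ℕ.* n)))

inM-sym : ∀ {n} (M : EdgeList n) u v → inM M u v ≡ inM M v u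
inM-sym [] u v = refl
inM-sym ((a , b) ∷ M) u v =
  cong₂ _∨_ (∨-comm (does (a Data.Fin.≟ u) ∧ does (b Data.Fin.≟ v)) _) (inM-sym M u v)

augAdj-sym : ∀ {n} (G : Graph n) M (u v : Fin n) → augAdj G M u v ≡ augAdj G M v u
augAdj-sym G M u v = cong₂ _∨_ (Graph.sym G u v) (inM-sym M u v)

module _ {n : ℕ} {a : Fin n → Fin n → Bool} where

  Walk-++ : ∀ {u w v l₁ l₂} → Walk a u w l₁ → Walk a w v l₂ → Walk a u v (l₁ ℕ.+ l₂)
  Walk-++ nil q = q
  Walk-++ (cons e p) q = cons e (Walk-++ p q)

  Walk-snoc : ∀ {u v w l} → Walk a u v l → a v w ≡ true → Walk a u w (ℕ.suc l)
  Walk-snoc p e = subst (Walk a _ _) (ℕ.+-comm _ 1) (Walk-++ p (cons e nil))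

  Walk-reverse : (∀ u v → a u v ≡ a v u) → ∀ {u v l} → Walk a u v l → Walk a v u l
  Walk-reverse a-sym nil = nil
  Walk-reverse a-sym (cons {u} {w} e p) = Walk-snoc (Walk-reverse a-sym p) (trans (a-sym w u) e)

  WalkWithin : Fin n → Fin n → ℕ → Set
  WalkWithin u v d = ∃[ l ] (Walk a u v l × l ≤ d)

  WalkWithin-weaken : ∀ {u v d d′} → d ≤ d′ → WalkWithin u v d → WalkWithin u v d′
  WalkWithin-weaken d≤d′ (l , p , l≤d) = l , p , ℕ.≤-trans l≤d d≤d′

  WalkWithin-reverse : (∀ u v → a u v ≡ a v u) → ∀ {u v d} → WalkWithin u v d → WalkWithin v u d
  WalkWithin-reverse a-sym (l , p , l≤d) = l , Walk-reverse a-sym p , l≤d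

  WalkWithin-++ : ∀ {u w v d₁ d₂} → WalkWithin u w d₁ → WalkWithin w v d₂ → WalkWithin u v (d₁ ℕ.+ d₂)
  WalkWithin-++ (l₁ , p₁ , l₁≤d₁) (l₂ , p₂ , l₂≤d₂) = l₁ ℕ.+ l₂ , Walk-++ p₁ p₂ , ℕ.+-mono-≤ l₁≤d₁ l₂≤d₂

  DistAtMost⇒WalkWithin : ∀ {u v d} → DistAtMost a u v (ℕtoℚ d) → WalkWithin u v d
  DistAtMost⇒WalkWithin (l , p , l≤d) = l , p , ℕtoℚ-cancel-≤ l≤d

  WalkWithin⇒DistAtMost : ∀ {u v d} → WalkWithin u v d → DistAtMost a u v (ℕtoℚ d)
  WalkWithin⇒DistAtMost (l , p , l≤d) = l , p , ℕtoℚ-mono-≤ l≤d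

  ColDiamAtMost⇒DiamAtMost : (∀ u v → a u v ≡ a v u) → (c : Fin n → Bool) →
    ∃[ u ] c u ≡ true → ∃[ v ] c v ≡ false → ∀ {d} →
    ColDiamAtMost c a (ℕtoℚ d) → DiamAtMost a (ℕtoℚ (2 ℕ.* d))
  ColDiamAtMost⇒DiamAtMost a-sym c (w₁ , cw₁) (w₂ , cw₂) {d} col u v =
    WalkWithin⇒DistAtMost (WalkWithin-weaken d+d≤2*d (within u v))
    where
      d+d≤2*d : d ℕ.+ d ≤ 2 ℕ.* d
      d+d≤2*d = ℕ.≤-reflexive (cong (d ℕ.+_) (≡-sym (ℕ.+-identityʳ d)))

      across : ∀ x y → c x ≡ true → c y ≡ false → WalkWithin x y d
      across x y cx cy = DistAtMost⇒WalkWithin (col x y cx cy)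

      within : ∀ x y → WalkWithin x y (d ℕ.+ d)
      within x y with c x in cx | c y in cy
      ... | true  | false = WalkWithin-weaken (ℕ.m≤m+n d d) (across x y cx cy)
      ... | false | true  = WalkWithin-weaken (ℕ.m≤m+n d d) (WalkWithin-reverse a-sym (across y x cy cx))
      ... | true  | true  = WalkWithin-++ (across x w₂ cx cw₂) (WalkWithin-reverse a-sym (across y w₂ cy cw₂))
      ... | false | false = WalkWithin-++ (WalkWithin-reverse a-sym (across w₁ x cw₁ cx)) (across w₁ y cw₁ cy)

α*2D≡2α*D : ∀ α D → α * ℕtoℚ (2 ℕ.* D) ≡ (ℕtoℚ 2 * α) * ℕtoℚ D
α*2D≡2α*D α D = begin
  α * ℕtoℚ (2 ℕ.* D)        ≡⟨ cong (α *_) (ℕtoℚ-*-homo 2 D) ⟩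
  α * (ℕtoℚ 2 * ℕtoℚ D)     ≡⟨ ℚ.*-assoc α (ℕtoℚ 2) (ℕtoℚ D) ⟨
  (α * ℕtoℚ 2) * ℕtoℚ D     ≡⟨ cong (_* ℕtoℚ D) (ℚ.*-comm α (ℕtoℚ 2)) ⟩
  (ℕtoℚ 2 * α) * ℕtoℚ D     ∎
  where open ≡-Reasoning

lemma4 : (α : ℚ) → 1ℚ Data.Rational.≤ α → (A : Algorithm) → IsApprox α A →
    ∀ n (G : Graph n) (k δ : ℕ) → 1 ≤ k → 1 ≤ δ →
    (c : Fin n → Bool) → ∃[ u ] c u ≡ true → ∃[ v ] c v ≡ false →
    ∀ (M : EdgeList n) (D : ℕ) → Feasible G k δ M →
    ColDiamAtMost c (augAdj G M) (ℕtoℚ D) →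
    ColDiamAtMost c (augAdj G (A n G k δ)) ((ℕtoℚ 2 * α) * ℕtoℚ D)
lemma4 α _ A A-approx n G k δ 1≤k 1≤δ c V₁≢∅ V₂≢∅ M D M-feasible M-colDiam u v _ _ =
  subst (DistAtMost (augAdj G (A n G k δ)) u v) (α*2D≡2α*D α D) (A-diam u v)
  where
    M-diam : DiamAtMost (augAdj G M) (ℕtoℚ (2 ℕ.* D))
    M-diam = ColDiamAtMost⇒DiamAtMost (augAdj-sym G M) c V₁≢∅ V₂≢∅ {D} M-colDiam

    A-diam : DiamAtMost (augAdj G (A n G k δ)) (α * ℕtoℚ (2 ℕ.* D))
    A-diam = proj₂ (A-approx n G k δ 1≤k 1≤δ) M (2 ℕ.* D) M-feasible M-diam
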